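{- For every $n\ge1$, $$\ddot{\mathrm{H}}^0(\Delta^n)\cong\bigoplus_{k=0}^n\mathbb{F}^{\binom{n+1}{k+1}}_{(k,k+1)},$$ where $\Delta^n$ is the $n$-simplex (with all its faces).
   Context: $\mathbb{F}$ is the field with two elements. For a finite simplicial complex $X$ with vertices $v_1,\dots,v_m$: a colouring $\varepsilon\in\mathbb{Z}_2^m$ colours $v_i$ black if $\varepsilon(i)=1$ and white otherwise; $|\varepsilon|$ is the number of black vertices; the weight of a simplex is its number of white vertices. The horizontal differential $\partial_h^\varepsilon$ on the simplicial chain complex $C(X)$ over $\mathbb{F}$ sends a simplex $\sigma$ to the sum of its faces $\sigma\setminus\{v\}$ over black $v\in\sigma$; $\mathrm{H}^h(X,\varepsilon)$ is its homology, bigraded by (dimension, weight). For $\varepsilon,\varepsilon'$ differing only at index $i$ with $\varepsilon(i)=0,\varepsilon'(i)=1$, $d_{\varepsilon\to\varepsilon'}:\mathrm{H}^h(X,\varepsilon)\to\mathrm{H}^h(X,\varepsilon')$ sends the class of a cycle $x$ to the class of the sum of the simplices of $x$ not containing $v_i$. The \"uber complex is $\ddot{C}^j(X)=\bigoplus_{|\varepsilon|=j}\mathrm{H}^h(X,\varepsilon)$ with differential the sum of these maps; its homology in homological degree $0$ is $\ddot{\mathrm{H}}^0(X)$. $\mathbb{F}^n_{(a,b)}$ denotes an $n$-dimensional space concentrated in (dimension, weight) $=(a,b)$. -}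

module Defs where

open import Data.Bool using (Bool; true; false; _∧_; _∨_; _xor_; not; if_then_else_)
open import Data.Nat using (ℕ; zero; suc; _+_; _≡ᵇ_; _≤ᵇ_)
open import Data.Nat.Combinatorics using (_C_)
open import Data.Fin using (Fin; zero; suc)
open import Data.Vec using (Vec; lookup; _[_]≔_)
open import Data.Product using (Σ; ∃; _×_; proj₁)
open import Relation.Binary.PropositionalEquality using (_≡_; _≗_)
open import Relation.Nullary using (¬_)

-- 𝔽 = Bool with _xor_ as addition and _∧_ as multiplication.

-- Vertices v_1..v_m are the elements of Fin m.
-- A simplex is a subset of the vertices (Vec Bool m, true = member).
Simplex : ℕ → Set
Simplex m = Vec Bool m

-- A colouring ε ∈ ℤ₂^m : true = black (ε(i)=1), false = white.
Colouring : ℕ → Set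
Colouring m = Vec Bool m

-- A finite simplicial complex on the vertex set Fin m, given by its
-- (decidable) set of faces.  Convention: faces are non-empty (the
-- ordinary, unreduced simplicial chain complex).
Complex : ℕ → Set
Complex m = Simplex m → Bool

⨁ : ∀ {m} → (Fin m → Bool) → Bool
⨁ {zero}  f = false
⨁ {suc m} f = f zero xor ⨁ (λ i → f (suc i))

count : ∀ {m} → (Fin m → Bool) → ℕ
count {zero}  f = 0
count {suc m} f = (if f zero then 1 else 0) + count (λ i → f (suc i))

-- number of vertices of a simplex (dimension + 1)
size : ∀ {m} → Simplex m → ℕ
size σ = count (lookup σ)

nonemptyᵇ : ∀ {m} → Simplex m → Bool
nonemptyᵇ σ = 1 ≤ᵇ size σ

weight : ∀ {m} → Colouring m → Simplex m → ℕ
weight ε σ = count (λ i → lookup σ i ∧ not (lookup ε i))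

∣_∣ᶜ : ∀ {m} → Colouring m → ℕ
∣ ε ∣ᶜ = count (lookup ε)

Chain : ℕ → Set
Chain m = Simplex m → Bool

-- c is a chain on X of bidegree (dimension a, weight b) w.r.t. ε
IsChain : ∀ {m} → Complex m → Colouring m → ℕ → ℕ → Chain m → Set
IsChain X ε a b c = ∀ σ → c σ ≡ true →
  (X σ ≡ true) × (size σ ≡ suc a) × (weight ε σ ≡ b)

-- horizontal differential: σ ↦ Σ_{v ∈ σ black} σ ∖ {v}
-- so (∂ c)(τ) = Σ_{v ∉ τ, v black} c(τ ∪ {v}), for τ non-empty.
∂ʰ : ∀ {m} → Colouring m → Chain m → Chain m
∂ʰ ε c τ = nonemptyᵇ τ ∧ ⨁ (λ v → lookup ε v ∧ (not (lookup τ v) ∧ c (τ [ v ]≔ true)))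

IsCycle : ∀ {m} → Colouring m → Chain m → Set
IsCycle ε c = ∀ τ → ∂ʰ ε c τ ≡ false

IsBoundary : ∀ {m} → Complex m → Colouring m → ℕ → ℕ → Chain m → Set
IsBoundary X ε a b c = ∃ λ e → IsChain X ε (suc a) b e × (∀ τ → ∂ʰ ε e τ ≡ c τ)

-- An element of C̈^j(X) in bidegree (a,b) is represented by
-- a family of horizontal cycles x ε (one for each colouring ε with |ε| = j,
-- zero otherwise), each representing a class of Hʰ(X,ε) in bidegree (a,b).
UChain : ℕ → Set
UChain m = Colouring m → Chain m

IsUCochain : ∀ {m} → Complex m → ℕ → ℕ → ℕ → UChain m → Set
IsUCochain X j a b x = ∀ ε →
  (∣ ε ∣ᶜ ≡ j → IsChain X ε a b (x ε) × IsCycle ε (x ε)) ×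
  (¬ (∣ ε ∣ᶜ ≡ j) → ∀ σ → x ε σ ≡ false)

-- equality in C̈^j = ⊕_{|ε|=j} Hʰ(X,ε): componentwise equality of classes
UEq : ∀ {m} → Complex m → ℕ → ℕ → ℕ → UChain m → UChain m → Set
UEq X j a b x y = ∀ ε → ∣ ε ∣ᶜ ≡ j → IsBoundary X ε a b (λ σ → x ε σ xor y ε σ)

zeroU : ∀ {m} → UChain m
zeroU ε σ = false

-- differential of the über complex: sum of the maps d_{ε→ε'}, where
-- d_{ε→ε'} keeps the simplices not containing v_i (ε' = ε with i turned black).
üd : ∀ {m} → UChain m → UChain m
üd x ε' τ = ⨁ (λ i → lookup ε' i ∧ (not (lookup τ i) ∧ x (ε' [ i ]≔ false) τ))

-- Ḧ^j(X) in bidegree (a,b): kernel of üd on C̈^j modulo image of C̈^(j-1)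
ÜH : ∀ {m} → Complex m → ℕ → ℕ → ℕ → Set
ÜH X j a b = Σ (UChain _) (λ x → IsUCochain X j a b x × UEq X (suc j) a b (üd x) zeroU)

ÜHEq : ∀ {m} (X : Complex m) (j a b : ℕ) → ÜH X j a b → ÜH X j a b → Set
ÜHEq X zero    a b x y = UEq X zero a b (proj₁ x) (proj₁ y)
ÜHEq X (suc j) a b x y = ∃ λ z → IsUCochain X j a b z ×
  UEq X (suc j) a b (λ ε σ → proj₁ x ε σ xor proj₁ y ε σ) (üd z)

record ÜHIso {m} (X : Complex m) (j a b N : ℕ) : Set where
  field
    to       : ÜH X j a b → (Fin N → Bool)
    from     : (Fin N → Bool) → ÜH X j a b
    to-cong  : ∀ x y → ÜHEq X j a b x y → to x ≗ to y
    from-cong : ∀ u v → u ≗ v → ÜHEq X j a b (from u) (from v)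
    to-from  : ∀ u → to (from u) ≗ u
    from-to  : ∀ x → ÜHEq X j a b (from (to x)) x
    to-additive : ∀ x y z → (∀ ε σ → proj₁ z ε σ ≡ (proj₁ x ε σ xor proj₁ y ε σ)) →
                  to z ≗ (λ k → to x k xor to y k)

Δ : (n : ℕ) → Complex (suc n)
Δ n σ = nonemptyᵇ σ

-- dimension of (⊕_{k=0}^n 𝔽^{C(n+1,k+1)}_{(k,k+1)}) in bidegree (a,b)
targetDim : ℕ → ℕ → ℕ → ℕ
targetDim n a b = if (b ≡ᵇ suc a) ∧ (a ≤ᵇ n) then (suc n) C (suc a) else 0

{-# OPTIONS --safe #-}
module Submission where

-- Only the all-white colouring has |ε| = 0, and for it the horizontal differential vanishes, so
-- C̈⁰(X) is the whole chain space C(X), in which a simplex of dimension k has weight k + 1.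
-- Every 0-cochain of Δⁿ is an über cocycle: if ε blackens only vᵢ, then d_{white→ε} x (the part
-- of x avoiding vᵢ) is the horizontal boundary of the cone σ ↦ σ ∪ {vᵢ} over x, which is again a
-- chain of Δⁿ.  Hence Ḧ⁰(Δⁿ) in bidegree (k, k+1) is spanned by the k-simplices of Δⁿ, of which
-- there are C(n+1, k+1), and it vanishes in every other bidegree.

open import Defs
open import Data.Nat using (ℕ; _≤_)
open import Data.Nat as ℕ using (zero; suc; _+_; _≡ᵇ_; _≤ᵇ_; s≤s; z≤n)
open import Data.Nat.Properties using (suc-injective; ≡ᵇ⇒≡; ≡⇒≡ᵇ; ≤⇒≤ᵇ; ≰⇒>)
open import Data.Nat.Combinatorics using (_C_; k>n⇒nCk≡0; nCk+nC[k+1]≡[n+1]C[k+1])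
open import Data.Bool using (Bool; true; false; _∧_; _xor_; not; T)
open import Data.Bool.Properties using (∧-zeroʳ; ∧-identityʳ; ∧-conicalˡ; ∧-conicalʳ; xor-same; xor-identityʳ; T-≡; ¬-not)
open import Data.Fin using (Fin; zero; suc; splitAt; _≟_)
open import Data.Fin.Properties using (splitAt⁻¹-↑ˡ; splitAt⁻¹-↑ʳ)
import Data.Fin.Properties as Finₚ
open import Data.Vec using ([]; _∷_; lookup; _[_]≔_; replicate)
open import Data.Vec.Properties using (lookup∘update; lookup∘update′; []≔-idempotent; []≔-lookup; lookup-replicate)
open import Data.Vec.Functional using (Vector; _++_; take; drop)
open import Data.Vec.Functional.Properties using (lookup-++ˡ; lookup-++ʳ; ++-cong)
open import Data.Sum using (inj₁; inj₂)
open import Data.Product using (Σ; _×_; _,_; proj₁; proj₂)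
open import Function using (_∘_)
open import Function.Bundles using (Equivalence)
open import Relation.Nullary using (¬_; yes; no; contradiction)
open import Relation.Binary.PropositionalEquality
open ≡-Reasoning

xor≡false⇒≡ : ∀ x y → x xor y ≡ false → x ≡ y
xor≡false⇒≡ true  true  _ = refl
xor≡false⇒≡ false false _ = refl

count-cong : ∀ {m} {f g : Fin m → Bool} → f ≗ g → count f ≡ count g
count-cong {zero}  f≗g = refl
count-cong {suc m} f≗g rewrite f≗g zero = cong (_ +_) (count-cong (λ i → f≗g (suc i)))

count≡0 : ∀ {m} (f : Fin m → Bool) → (∀ i → f i ≡ false) → count f ≡ 0
count≡0 {zero}  f f≡false = refl
count≡0 {suc m} f f≡false rewrite f≡false zero = count≡0 _ (λ i → f≡false (suc i))

count≡0⇒≡false : ∀ {m} (f : Fin m → Bool) → count f ≡ 0 → ∀ i → f i ≡ false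
count≡0⇒≡false {suc m} f count≡0 i with f zero in f₀
count≡0⇒≡false {suc m} f count≡0 zero    | false = f₀
count≡0⇒≡false {suc m} f count≡0 (suc i) | false = count≡0⇒≡false (λ j → f (suc j)) count≡0 i

count≡1⇒unique : ∀ {m} (f : Fin m → Bool) → count f ≡ 1 →
                 Σ (Fin m) λ i → f i ≡ true × (∀ j → j ≢ i → f j ≡ false)
count≡1⇒unique {suc m} f count≡1 with f zero in f₀
... | true  = zero , f₀ , λ { zero j≢0 → contradiction refl j≢0
                            ; (suc j) _ → count≡0⇒≡false (λ j → f (suc j)) (suc-injective count≡1) j }
... | false with count≡1⇒unique (λ j → f (suc j)) count≡1
...   | i , fi , others = suc i , fi , λ { zero _ → f₀ ; (suc j) j≢i → others j (λ j≡i → j≢i (cong suc j≡i)) }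

count-insert : ∀ {m} (f g : Fin m → Bool) (i : Fin m) → f i ≡ true → g i ≡ false →
               (∀ j → i ≢ j → f j ≡ g j) → count f ≡ suc (count g)
count-insert f g zero fi gi f≡g rewrite fi | gi = cong suc (count-cong (λ j → f≡g (suc j) (λ ())))
count-insert f g (suc i) fi gi f≡g rewrite f≡g zero (λ ()) with g zero
... | true  = cong suc (count-insert _ _ i fi gi (λ j i≢j → f≡g (suc j) (λ p → i≢j (Finₚ.suc-injective p))))
... | false = count-insert _ _ i fi gi (λ j i≢j → f≡g (suc j) (λ p → i≢j (Finₚ.suc-injective p)))

⨁-zero : ∀ {m} {f : Fin m → Bool} → (∀ i → f i ≡ false) → ⨁ f ≡ false
⨁-zero {zero}  f≡false = refl
⨁-zero {suc m} f≡false rewrite f≡false zero = ⨁-zero (λ i → f≡false (suc i))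

⨁-single : ∀ {m} (f : Fin m → Bool) (i : Fin m) → (∀ j → j ≢ i → f j ≡ false) → ⨁ f ≡ f i
⨁-single f zero others rewrite ⨁-zero {f = λ j → f (suc j)} (λ j → others (suc j) (λ ())) =
  xor-identityʳ (f zero)
⨁-single f (suc i) others rewrite others zero (λ ()) =
  ⨁-single (λ j → f (suc j)) i (λ j j≢i → others (suc j) (λ p → j≢i (Finₚ.suc-injective p)))

White : ∀ {m} → Colouring m → Set
White ε = ∀ i → lookup ε i ≡ false

allWhite : ∀ m → Colouring m
allWhite m = replicate m false

allWhite-white : ∀ m → White (allWhite m)
allWhite-white m i = lookup-replicate i false

∣allWhite∣≡0 : ∀ m → ∣ allWhite m ∣ᶜ ≡ 0
∣allWhite∣≡0 m = count≡0 _ (allWhite-white m)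

∣∣≡0⇒white : ∀ {m} (ε : Colouring m) → ∣ ε ∣ᶜ ≡ 0 → White ε
∣∣≡0⇒white ε = count≡0⇒≡false (lookup ε)

white⇒≡allWhite : ∀ {m} (ε : Colouring m) → White ε → ε ≡ allWhite m
white⇒≡allWhite []      _       = refl
white⇒≡allWhite (_ ∷ ε) ε-white = cong₂ _∷_ (ε-white zero) (white⇒≡allWhite ε (λ i → ε-white (suc i)))

∂ʰ-white : ∀ {m} (ε : Colouring m) → White ε → ∀ c τ → ∂ʰ ε c τ ≡ false
∂ʰ-white ε ε-white c τ =
  trans (cong (nonemptyᵇ τ ∧_) (⨁-zero (λ v → cong (_∧ _) (ε-white v)))) (∧-zeroʳ (nonemptyᵇ τ))

weight-white : ∀ {m} (ε : Colouring m) → White ε → ∀ σ → weight ε σ ≡ size σ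
weight-white ε ε-white σ =
  count-cong (λ i → trans (cong (λ εᵢ → lookup σ i ∧ not εᵢ) (ε-white i)) (∧-identityʳ _))

module _ {m} (X : Complex m) (a b : ℕ) where

  UEq₀⇒pointwise : ∀ x y → UEq X 0 a b x y → ∀ ε → ∣ ε ∣ᶜ ≡ 0 → x ε ≗ y ε
  UEq₀⇒pointwise x y x≈y ε ∣ε∣≡0 σ with x≈y ε ∣ε∣≡0
  ... | e , _ , ∂e≡x+y =
    xor≡false⇒≡ _ _ (trans (sym (∂e≡x+y σ)) (∂ʰ-white ε (∣∣≡0⇒white ε ∣ε∣≡0) e σ))

  pointwise⇒UEq₀ : ∀ x y → (∀ ε → ∣ ε ∣ᶜ ≡ 0 → x ε ≗ y ε) → UEq X 0 a b x y
  pointwise⇒UEq₀ x y x≗y ε ∣ε∣≡0 = (λ _ → false) , (λ _ ()) , λ τ → begin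
    ∂ʰ ε (λ _ → false) τ ≡⟨ ∂ʰ-white ε (∣∣≡0⇒white ε ∣ε∣≡0) _ τ ⟩
    false                ≡⟨ sym (xor-same (y ε τ)) ⟩
    y ε τ xor y ε τ      ≡⟨ cong (_xor y ε τ) (sym (x≗y ε ∣ε∣≡0 τ)) ⟩
    x ε τ xor y ε τ      ∎

size≡suc⇒nonempty : ∀ {m} (σ : Simplex m) {k} → size σ ≡ suc k → nonemptyᵇ σ ≡ true
size≡suc⇒nonempty σ size≡suc = cong (1 ≤ᵇ_) size≡suc

size-remove : ∀ {m} (σ : Simplex m) i → lookup σ i ≡ true → size σ ≡ suc (size (σ [ i ]≔ false))
size-remove σ i σᵢ = count-insert (lookup σ) (lookup (σ [ i ]≔ false)) i σᵢ (lookup∘update i σ false)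
  (λ j i≢j → sym (lookup∘update′ (≢-sym i≢j) σ false))

weight-remove-black : ∀ {m} (ε : Colouring m) σ i → lookup ε i ≡ true →
                      weight ε σ ≡ weight (ε [ i ]≔ false) (σ [ i ]≔ false)
weight-remove-black ε σ i εᵢ = count-cong same-white
  where
  same-white : ∀ j → lookup σ j ∧ not (lookup ε j) ≡ lookup (σ [ i ]≔ false) j ∧ not (lookup (ε [ i ]≔ false) j)
  same-white j with j ≟ i
  ... | yes refl rewrite εᵢ | lookup∘update j σ false = ∧-zeroʳ (lookup σ j)
  ... | no j≢i rewrite lookup∘update′ j≢i σ false | lookup∘update′ j≢i ε false = refl

insert-remove : ∀ {m} (τ : Simplex m) i → lookup τ i ≡ false → (τ [ i ]≔ true) [ i ]≔ false ≡ τ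
insert-remove τ i τᵢ = begin
  (τ [ i ]≔ true) [ i ]≔ false ≡⟨ []≔-idempotent τ i ⟩
  τ [ i ]≔ false               ≡⟨ cong (τ [ i ]≔_) (sym τᵢ) ⟩
  τ [ i ]≔ lookup τ i          ≡⟨ []≔-lookup τ i ⟩
  τ                            ∎

module Cone {n a b} (x : UChain (suc n)) (x-cochain : IsUCochain (Δ n) 0 a b x)
            (ε : Colouring (suc n)) (i : Fin (suc n))
            (εᵢ : lookup ε i ≡ true) (others : ∀ j → j ≢ i → lookup ε j ≡ false)
            where

  W : Colouring (suc n)
  W = ε [ i ]≔ false

  W-white : White W
  W-white j with j ≟ i
  ... | yes refl = lookup∘update j ε false
  ... | no j≢i   = trans (lookup∘update′ j≢i ε false) (others j j≢i)

  x-chain : IsChain (Δ n) W a b (x W)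
  x-chain = proj₁ (proj₁ (x-cochain W) (count≡0 _ W-white))

  cone : Chain (suc n)
  cone σ = lookup σ i ∧ x W (σ [ i ]≔ false)

  cone-isChain : IsChain (Δ n) ε (suc a) b cone
  cone-isChain σ coneσ =
    size≡suc⇒nonempty σ size-σ , trans size-σ (cong suc size-σ′) , trans (weight-remove-black ε σ i εᵢ) weight-σ′
    where
    σ′-chain = x-chain (σ [ i ]≔ false) (∧-conicalʳ _ _ coneσ)
    size-σ′ = proj₁ (proj₂ σ′-chain)
    weight-σ′ = proj₂ (proj₂ σ′-chain)
    size-σ = size-remove σ i (∧-conicalˡ _ _ coneσ)

  ∂ʰ-cone : ∀ τ → ∂ʰ ε cone τ ≡ (üd x ε τ xor false)
  ∂ʰ-cone τ = begin
    nonemptyᵇ τ ∧ ⨁ F  ≡⟨ cong (nonemptyᵇ τ ∧_) (⨁-single F i (only-i-black ∂-term)) ⟩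
    nonemptyᵇ τ ∧ F i  ≡⟨ cone-face ⟩
    G i                ≡⟨ sym (⨁-single G i (only-i-black üd-term)) ⟩
    üd x ε τ           ≡⟨ sym (xor-identityʳ _) ⟩
    üd x ε τ xor false ∎
    where
    ∂-term üd-term F G : Fin (suc n) → Bool
    ∂-term v = not (lookup τ v) ∧ cone (τ [ v ]≔ true)
    üd-term v = not (lookup τ v) ∧ x (ε [ v ]≔ false) τ
    F v = lookup ε v ∧ ∂-term v
    G v = lookup ε v ∧ üd-term v

    only-i-black : ∀ (f : Fin (suc n) → Bool) j → j ≢ i → lookup ε j ∧ f j ≡ false
    only-i-black f j j≢i = cong (_∧ f j) (others j j≢i)

    x-support : nonemptyᵇ τ ∧ x W τ ≡ x W τ
    x-support with x W τ in xτ
    ... | true  = cong (_∧ true) (proj₁ (x-chain τ xτ))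
    ... | false = ∧-zeroʳ _

    cone-face : nonemptyᵇ τ ∧ F i ≡ G i
    cone-face rewrite εᵢ with lookup τ i in τᵢ
    ... | true  = ∧-zeroʳ _
    ... | false = begin
      nonemptyᵇ τ ∧ (lookup (τ [ i ]≔ true) i ∧ x W ((τ [ i ]≔ true) [ i ]≔ false))
        ≡⟨ cong₂ (λ t s → nonemptyᵇ τ ∧ (t ∧ x W s)) (lookup∘update i τ true) (insert-remove τ i τᵢ) ⟩
      nonemptyᵇ τ ∧ x W τ
        ≡⟨ x-support ⟩
      x W τ ∎

üd-Δ-cocycle : ∀ n a b x → IsUCochain (Δ n) 0 a b x → UEq (Δ n) 1 a b (üd x) zeroU
üd-Δ-cocycle n a b x x-cochain ε ∣ε∣≡1 with count≡1⇒unique (lookup ε) ∣ε∣≡1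
... | i , εᵢ , others = cone , cone-isChain , ∂ʰ-cone
  where open Cone x x-cochain ε i εᵢ others

binomial : ℕ → ℕ → ℕ
binomial zero    zero    = 1
binomial zero    (suc k) = 0
binomial (suc m) zero    = binomial m zero
binomial (suc m) (suc k) = binomial m k + binomial m (suc k)

binomial≡C : ∀ m k → binomial m k ≡ m C k
binomial≡C zero    zero    = refl
binomial≡C zero    (suc k) = sym (k>n⇒nCk≡0 {0} {suc k} (s≤s z≤n))
binomial≡C (suc m) zero    = binomial≡C m zero
binomial≡C (suc m) (suc k) = begin
  binomial m k + binomial m (suc k) ≡⟨ cong₂ _+_ (binomial≡C m k) (binomial≡C m (suc k)) ⟩
  m C k + m C suc k                 ≡⟨ nCk+nC[k+1]≡[n+1]C[k+1] m k ⟩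
  suc m C suc k                     ∎

take++drop : ∀ {A : Set} m {n} (u : Vector A (m + n)) → take m u ++ drop m u ≗ u
take++drop m u i with splitAt m i in split
... | inj₁ j = cong u (splitAt⁻¹-↑ˡ split)
... | inj₂ j = cong u (splitAt⁻¹-↑ʳ split)

-- Coordinates of a chain in the basis of k-element vertex sets, ordered by Pascal's recursion:
-- first the sets containing the first vertex, then those avoiding it.
coordinates : ∀ m k → Chain m → Vector Bool (binomial m k)
coordinates zero    zero    c = λ _ → c []
coordinates zero    (suc k) c = λ ()
coordinates (suc m) zero    c = coordinates m zero (λ σ → c (false ∷ σ))
coordinates (suc m) (suc k) c =
  coordinates m k (λ σ → c (true ∷ σ)) ++ coordinates m (suc k) (λ σ → c (false ∷ σ))

fromCoordinates : ∀ m k → Vector Bool (binomial m k) → Chain m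
fromCoordinates zero    zero    u []          = u zero
fromCoordinates zero    (suc k) u []          = false
fromCoordinates (suc m) zero    u (true  ∷ σ) = false
fromCoordinates (suc m) zero    u (false ∷ σ) = fromCoordinates m zero u σ
fromCoordinates (suc m) (suc k) u (true  ∷ σ) = fromCoordinates m k (take (binomial m k) u) σ
fromCoordinates (suc m) (suc k) u (false ∷ σ) = fromCoordinates m (suc k) (drop (binomial m k) u) σ

fromCoordinates-size : ∀ m k u σ → fromCoordinates m k u σ ≡ true → size σ ≡ k
fromCoordinates-size zero    zero    u []          _ = refl
fromCoordinates-size zero    (suc k) u []          ()
fromCoordinates-size (suc m) zero    u (true  ∷ σ) ()
fromCoordinates-size (suc m) zero    u (false ∷ σ) p = fromCoordinates-size m zero u σ p
fromCoordinates-size (suc m) (suc k) u (true  ∷ σ) p = cong suc (fromCoordinates-size m k _ σ p)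
fromCoordinates-size (suc m) (suc k) u (false ∷ σ) p = fromCoordinates-size m (suc k) _ σ p

fromCoordinates-cong : ∀ m k {u v} → u ≗ v → fromCoordinates m k u ≗ fromCoordinates m k v
fromCoordinates-cong zero    zero    u≗v []          = u≗v zero
fromCoordinates-cong zero    (suc k) u≗v []          = refl
fromCoordinates-cong (suc m) zero    u≗v (true  ∷ σ) = refl
fromCoordinates-cong (suc m) zero    u≗v (false ∷ σ) = fromCoordinates-cong m zero u≗v σ
fromCoordinates-cong (suc m) (suc k) u≗v (true  ∷ σ) = fromCoordinates-cong m k (λ i → u≗v _) σ
fromCoordinates-cong (suc m) (suc k) u≗v (false ∷ σ) = fromCoordinates-cong m (suc k) (λ i → u≗v _) σ

coordinates-cong : ∀ m k {c d} → c ≗ d → coordinates m k c ≗ coordinates m k d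
coordinates-cong zero    zero    c≗d i  = c≗d []
coordinates-cong zero    (suc k) c≗d ()
coordinates-cong (suc m) zero    c≗d i  = coordinates-cong m zero (λ σ → c≗d _) i
coordinates-cong (suc m) (suc k) c≗d i  =
  ++-cong _ _ (coordinates-cong m k (λ σ → c≗d _)) (coordinates-cong m (suc k) (λ σ → c≗d _)) i

coordinates-xor : ∀ m k c d i →
                  coordinates m k (λ σ → c σ xor d σ) i ≡ (coordinates m k c i xor coordinates m k d i)
coordinates-xor zero    zero    c d i  = refl
coordinates-xor zero    (suc k) c d ()
coordinates-xor (suc m) zero    c d i  = coordinates-xor m zero _ _ i
coordinates-xor (suc m) (suc k) c d i with splitAt (binomial m k) i
... | inj₁ j = coordinates-xor m k _ _ j
... | inj₂ j = coordinates-xor m (suc k) _ _ j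

coordinates-fromCoordinates : ∀ m k u → coordinates m k (fromCoordinates m k u) ≗ u
coordinates-fromCoordinates zero    zero    u zero = refl
coordinates-fromCoordinates zero    (suc k) u ()
coordinates-fromCoordinates (suc m) zero    u i    = coordinates-fromCoordinates m zero u i
coordinates-fromCoordinates (suc m) (suc k) u i    = begin
  (coordinates m k _ ++ coordinates m (suc k) _) i
    ≡⟨ ++-cong _ _ (coordinates-fromCoordinates m k _) (coordinates-fromCoordinates m (suc k) _) i ⟩
  (take (binomial m k) u ++ drop (binomial m k) u) i
    ≡⟨ take++drop (binomial m k) u i ⟩
  u i ∎

fromCoordinates-coordinates : ∀ m k c σ → size σ ≡ k → fromCoordinates m k (coordinates m k c) σ ≡ c σ
fromCoordinates-coordinates zero    zero    c []          _ = refl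
fromCoordinates-coordinates zero    (suc k) c []          ()
fromCoordinates-coordinates (suc m) zero    c (true  ∷ σ) ()
fromCoordinates-coordinates (suc m) zero    c (false ∷ σ) p = fromCoordinates-coordinates m zero _ σ p
fromCoordinates-coordinates (suc m) (suc k) c (true  ∷ σ) p =
  trans (fromCoordinates-cong m k (lookup-++ˡ (coordinates m k _) (coordinates m (suc k) _)) σ)
        (fromCoordinates-coordinates m k _ σ (suc-injective p))
fromCoordinates-coordinates (suc m) (suc k) c (false ∷ σ) p =
  trans (fromCoordinates-cong m (suc k) (lookup-++ʳ (coordinates m k _) (coordinates m (suc k) _)) σ)
        (fromCoordinates-coordinates m (suc k) _ σ p)

white-chain-weight≡dim+1 : ∀ {m} {X : Complex m} {a b c} → IsChain X (allWhite m) a b c →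
                    ∀ σ → c σ ≡ true → b ≡ suc a
white-chain-weight≡dim+1 {m} c-chain σ cσ with c-chain σ cσ
... | _ , size≡ , weight≡ = trans (sym weight≡) (trans (weight-white (allWhite m) (allWhite-white m) σ) size≡)

onWhite : ∀ {m} → Chain m → UChain m
onWhite c ε σ = (∣ ε ∣ᶜ ≡ᵇ 0) ∧ c σ

onWhite-white : ∀ {m} (c : Chain m) ε → ∣ ε ∣ᶜ ≡ 0 → onWhite c ε ≗ c
onWhite-white c ε ∣ε∣≡0 σ = cong (λ k → (k ≡ᵇ 0) ∧ c σ) ∣ε∣≡0

onWhite-isUCochain : ∀ {m} {X : Complex m} {a b c} → IsChain X (allWhite m) a b c →
                     IsUCochain X 0 a b (onWhite c)
onWhite-isUCochain {m} {X} {a} {b} {c} c-chain ε = white-part , black-part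
  where
  white-part : ∣ ε ∣ᶜ ≡ 0 → IsChain X ε a b (onWhite c ε) × IsCycle ε (onWhite c ε)
  white-part ∣ε∣≡0 rewrite white⇒≡allWhite ε (∣∣≡0⇒white ε ∣ε∣≡0) =
    (λ σ onWhiteσ → c-chain σ (∧-conicalʳ _ _ onWhiteσ)) ,
    ∂ʰ-white (allWhite m) (allWhite-white m) (onWhite c (allWhite m))

  black-part : ¬ ∣ ε ∣ᶜ ≡ 0 → ∀ σ → onWhite c ε σ ≡ false
  black-part ∣ε∣≢0 σ with ∣ ε ∣ᶜ
  ... | zero  = contradiction refl ∣ε∣≢0
  ... | suc _ = refl

record WhiteChainCoordinates {m} (X : Complex m) (a b N : ℕ) : Set where
  field
    coords        : Chain m → Vector Bool N
    chain         : Vector Bool N → Chain m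
    chain-isChain : ∀ u → IsChain X (allWhite m) a b (chain u)
    chain-cong    : ∀ {u v} → u ≗ v → chain u ≗ chain v
    coords-cong   : ∀ {c d} → c ≗ d → coords c ≗ coords d
    coords-xor    : ∀ c d i → coords (λ σ → c σ xor d σ) i ≡ (coords c i xor coords d i)
    coords-chain  : ∀ u → coords (chain u) ≗ u
    chain-coords  : ∀ c → IsChain X (allWhite m) a b c → chain (coords c) ≗ c

module _ {n a b N} (basis : WhiteChainCoordinates (Δ n) a b N) where
  open WhiteChainCoordinates basis

  private
    W = allWhite (suc n)
    ∣W∣≡0 = ∣allWhite∣≡0 (suc n)

  ÜH-class : Vector Bool N → ÜH (Δ n) 0 a b
  ÜH-class u = onWhite (chain u) , cochain , üd-Δ-cocycle n a b _ cochain
    where cochain = onWhite-isUCochain (chain-isChain u)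

  coordinates⇒ÜHIso : ÜHIso (Δ n) 0 a b N
  coordinates⇒ÜHIso = record
    { to          = λ x → coords (proj₁ x W)
    ; from        = ÜH-class
    ; to-cong     = λ x y x≈y → coords-cong (UEq₀⇒pointwise (Δ n) a b (proj₁ x) (proj₁ y) x≈y W ∣W∣≡0)
    ; from-cong   = λ u v u≗v →
        pointwise⇒UEq₀ (Δ n) a b _ _ λ ε _ σ → cong ((∣ ε ∣ᶜ ≡ᵇ 0) ∧_) (chain-cong u≗v σ)
    ; to-from     = λ u i → trans (coords-cong (onWhite-white (chain u) W ∣W∣≡0) i) (coords-chain u i)
    ; from-to     = λ x → pointwise⇒UEq₀ (Δ n) a b _ _ (from-to-white x)
    ; to-additive = λ x y z z≡x+y i → trans (coords-cong (z≡x+y W) i) (coords-xor _ _ i)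
    }
    where
    from-to-white : ∀ x ε → ∣ ε ∣ᶜ ≡ 0 → onWhite (chain (coords (proj₁ x W))) ε ≗ proj₁ x ε
    from-to-white (x , x-cochain , _) ε ∣ε∣≡0 σ rewrite white⇒≡allWhite ε (∣∣≡0⇒white ε ∣ε∣≡0) =
      trans (onWhite-white (chain (coords (x W))) W ∣W∣≡0 σ)
            (chain-coords (x W) (proj₁ (proj₁ (x-cochain W) ∣W∣≡0)) σ)

diagonalCoordinates : ∀ n a → WhiteChainCoordinates (Δ n) a (suc a) (binomial (suc n) (suc a))
diagonalCoordinates n a = record
  { coords        = coordinates (suc n) (suc a)
  ; chain         = fromCoordinates (suc n) (suc a)
  ; chain-isChain = chain-isChain
  ; chain-cong    = fromCoordinates-cong (suc n) (suc a)
  ; coords-cong   = coordinates-cong (suc n) (suc a)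
  ; coords-xor    = coordinates-xor (suc n) (suc a)
  ; coords-chain  = coordinates-fromCoordinates (suc n) (suc a)
  ; chain-coords  = chain-coords
  }
  where
  chain-isChain : ∀ u → IsChain (Δ n) (allWhite (suc n)) a (suc a) (fromCoordinates (suc n) (suc a) u)
  chain-isChain u σ uσ =
    size≡suc⇒nonempty σ size≡ , size≡ , trans (weight-white (allWhite (suc n)) (allWhite-white (suc n)) σ) size≡
    where size≡ = fromCoordinates-size (suc n) (suc a) u σ uσ

  chain-coords : ∀ c → IsChain (Δ n) (allWhite (suc n)) a (suc a) c →
                 fromCoordinates (suc n) (suc a) (coordinates (suc n) (suc a) c) ≗ c
  chain-coords c c-chain σ with size σ ℕ.≟ suc a
  ... | yes size≡ = fromCoordinates-coordinates (suc n) (suc a) c σ size≡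
  ... | no  size≢ = trans (¬-not (size≢ ∘ fromCoordinates-size (suc n) (suc a) _ σ))
                          (sym (¬-not (size≢ ∘ proj₁ ∘ proj₂ ∘ c-chain σ)))

offDiagonalCoordinates : ∀ n {a b} → b ≢ suc a → WhiteChainCoordinates (Δ n) a b 0
offDiagonalCoordinates n b≢ = record
  { coords        = λ _ ()
  ; chain         = λ _ _ → false
  ; chain-isChain = λ _ _ ()
  ; chain-cong    = λ _ _ → refl
  ; coords-cong   = λ _ ()
  ; coords-xor    = λ _ _ ()
  ; coords-chain  = λ _ ()
  ; chain-coords  = λ c c-chain σ → sym (¬-not (b≢ ∘ white-chain-weight≡dim+1 c-chain σ))
  }

targetDim-diagonal : ∀ n a → targetDim n a (suc a) ≡ binomial (suc n) (suc a)
targetDim-diagonal n a rewrite Equivalence.to T-≡ (≡⇒≡ᵇ a a refl) with a ≤ᵇ n in a≤ᵇn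
... | true  = sym (binomial≡C (suc n) (suc a))
... | false = sym (trans (binomial≡C (suc n) (suc a)) (k>n⇒nCk≡0 {suc n} {suc a} (s≤s (≰⇒> a≰n))))
  where a≰n = λ a≤n → subst T a≤ᵇn (≤⇒≤ᵇ a≤n)

targetDim-offDiagonal : ∀ n {a b} → b ≢ suc a → targetDim n a b ≡ 0
targetDim-offDiagonal n {a} {b} b≢ with b ≡ᵇ suc a in b≡ᵇ
... | false = refl
... | true  = contradiction (≡ᵇ⇒≡ b (suc a) (Equivalence.from T-≡ b≡ᵇ)) b≢

corollary7p5 : (n : ℕ) → 1 ≤ n → (a b : ℕ) → ÜHIso (Δ n) 0 a b (targetDim n a b)
corollary7p5 n _ a b with b ℕ.≟ suc a
... | yes refl = subst (ÜHIso (Δ n) 0 a b) (sym (targetDim-diagonal n a))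
                       (coordinates⇒ÜHIso (diagonalCoordinates n a))
... | no  b≢   = subst (ÜHIso (Δ n) 0 a b) (sym (targetDim-offDiagonal n b≢))
                       (coordinates⇒ÜHIso (offDiagonalCoordinates n b≢))
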